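{- Let $\mathcal{M}$ be a finite unitary magma with $m$ elements. The Hilbert series $\mathcal{H}(t):=\sum_{n\geq1}\dim\mathrm{NC}\mathcal{M}(n)\,t^n$ of $\mathrm{NC}\mathcal{M}$ satisfies $$t+\left(m^3-2m^2+2m-1\right)t^2+\left(2m^2t-3mt+2t-1\right)\mathcal{H}(t)+(m-1)\,\mathcal{H}(t)^2=0.$$
   Context: A unitary magma is a set $\mathcal{M}$ with a binary operation $\star$ admitting a two-sided unit $\mathds{1}_\mathcal{M}$. For $n\geq 1$, an $\mathcal{M}$-clique of size $n$ is a complete graph on the vertex set $[n+1]$ with a labeling of each arc $(x,y)$, $1\le x<y\le n+1$, by an element of $\mathcal{M}$; $(1,n+1)$ is the base, arcs $(i,i+1)$ are edges, and all other arcs are diagonals. An arc is solid if its label is not $\mathds{1}_\mathcal{M}$. Two diagonals $(x,y),(x',y')$ cross if $x<x'<y<y'$ or $x'<x<y'<y$. $\mathrm{NC}\mathcal{M}$ is the graded vector space (an operad, suboperad of the operad of $\mathcal{M}$-cliques) with $\mathrm{NC}\mathcal{M}(1)$ one-dimensional, spanned by the size-1 clique with base labeled $\mathds{1}_\mathcal{M}$, and, for $n\geq2$, $\mathrm{NC}\mathcal{M}(n)$ having as basis all $\mathcal{M}$-cliques of size $n$ with no two crossing solid diagonals. -}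

module Defs where

open import Level using (0ℓ)
open import Data.Nat as ℕ using (ℕ; zero; suc)
open import Data.Integer as ℤ using (ℤ; +_)
open import Data.Bool using (Bool; true; false; _∧_; _∨_; not; if_then_else_)
open import Data.Fin using (Fin)
open import Data.Fin.Properties using () renaming (_≟_ to _≟F_)
open import Data.List using (List; []; _∷_; length; filter; map; concatMap; allFin; upTo; foldr; zip)
open import Data.Vec as V using (Vec; []; _∷_; toList)
open import Data.Product using (_×_; _,_; proj₁; proj₂)
open import Relation.Nullary using (does; yes; no)
open import Relation.Nullary.Decidable using (T?)
open import Relation.Binary.PropositionalEquality using (_≡_; cong)
open import Function.Bundles using (_↔_; Inverse)
open import Algebra.Structures using (IsUnitalMagma)

record FiniteUnitaryMagma (m : ℕ) : Set₁ where
  field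
    Carrier        : Set
    _⋆_            : Carrier → Carrier → Carrier
    𝟙              : Carrier
    isUnitalMagma  : IsUnitalMagma {A = Carrier} _≡_ _⋆_ 𝟙
    enumeration    : Fin m ↔ Carrier

  open Inverse enumeration public using (to; from; strictlyInverseʳ)

  isUnit : Carrier → Bool
  isUnit a = does (from a ≟F from 𝟙)

  elements : List Carrier
  elements = map to (allFin m)

-- Arcs of a clique of size n: pairs (x , y) with 1 ≤ x < y ≤ n+1,
-- listed in a fixed order.

arcs : ℕ → List (ℕ × ℕ)
arcs n = concatMap (λ x → map (λ d → (suc x , suc x ℕ.+ suc d)) (upTo (n ℕ.∸ x)))
                   (upTo n)

nArcs : ℕ → ℕ
nArcs n = length (arcs n)

-- (x , y) is a diagonal of a clique of size n: neither an edge (y = x+1)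
-- nor the base (x = 1 and y = n+1)
isDiagonal : ℕ → ℕ × ℕ → Bool
isDiagonal n (x , y) = (suc x ℕ.<ᵇ y) ∧ not ((x ℕ.≡ᵇ 1) ∧ (y ℕ.≡ᵇ suc n))

crosses : ℕ × ℕ → ℕ × ℕ → Bool
crosses (x , y) (x' , y') =
  ((x ℕ.<ᵇ x') ∧ (x' ℕ.<ᵇ y) ∧ (y ℕ.<ᵇ y')) ∨
  ((x' ℕ.<ᵇ x) ∧ (x ℕ.<ᵇ y') ∧ (y' ℕ.<ᵇ y))

allB : {A : Set} → (A → Bool) → List A → Bool
allB p = foldr (λ a b → p a ∧ b) true

module _ {m : ℕ} (M : FiniteUnitaryMagma m) where
  open FiniteUnitaryMagma M

  -- An M-clique of size n: a label for each arc, given in the order of `arcs n`.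
  Clique : ℕ → Set
  Clique n = Vec Carrier (nArcs n)

  labelledArcs : (n : ℕ) → Clique n → List ((ℕ × ℕ) × Carrier)
  labelledArcs n c = zip (arcs n) (toList c)

  solidDiagonals : (n : ℕ) → Clique n → List (ℕ × ℕ)
  solidDiagonals n c =
    map proj₁ (filter (λ p → T? (isDiagonal n (proj₁ p) ∧ not (isUnit (proj₂ p))))
                      (labelledArcs n c))

  noncrossing : (n : ℕ) → Clique n → Bool
  noncrossing n c = let ds = solidDiagonals n c in
    allB (λ d → allB (λ d' → not (crosses d d')) ds) ds

  allVecs : (k : ℕ) → List (Vec Carrier k)
  allVecs zero    = [] ∷ []
  allVecs (suc k) = concatMap (λ a → map (a ∷_) (allVecs k)) elements

  -- dim NCM(n): 0 for n = 0 (no such component), 1 for n = 1,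
  -- and for n ≥ 2 the number of M-cliques of size n without crossing solid diagonals
  dimNC : ℕ → ℕ
  dimNC zero          = 0
  dimNC (suc zero)    = 1
  dimNC n@(suc (suc _)) =
    length (filter (λ c → T? (noncrossing n c)) (allVecs (nArcs n)))

PS : Set
PS = ℕ → ℤ

infixl 6 _⊕_
infixl 7 _⊛_ _·_

_⊕_ : PS → PS → PS
(f ⊕ g) n = f n ℤ.+ g n

_·_ : ℤ → PS → PS
(a · f) n = a ℤ.* f n

_⊛_ : PS → PS → PS
(f ⊛ g) n = foldr ℤ._+_ (+ 0) (map (λ i → f i ℤ.* g (n ℕ.∸ i)) (upTo (suc n)))

const : ℤ → PS
const c zero    = c
const c (suc _) = + 0

tpow : ℕ → PS
tpow k n = if k ℕ.≡ᵇ n then + 1 else + 0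

𝐭 : PS
𝐭 = tpow 1

𝟘 : PS
𝟘 _ = + 0

hilbert : {m : ℕ} → FiniteUnitaryMagma m → PS
hilbert M n = + dimNC M n

module Submission where

-- Write d n = dim NCM(n) and w = m - 1 (the number of non-unit labels).  Comparing
-- coefficients, the equation amounts to d 1 = 1, d 2 = m³ and, for l ≥ 0,
--   d (l+3) = (2m² - 3m + 2) d (l+2) + (m - 1) [t^(l+3)] H².
-- To prove the recurrence we count the cliques of size n ≥ 2 arc by arc
-- (`SequentialCount`): an edge or the base takes any of the m labels, a diagonal
-- the unit or, when no earlier solid diagonal crosses it, one of w solid labels.
-- Taking the arcs row by row (by first vertex, `ArcRows`), the arcs forbidden in
-- the remaining rows are those containing a vertex marked as the far end of an
-- earlier solid diagonal (`RowByRow`), so the count only depends on the gaps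
-- between marked vertices.  This count (`GapCounts.fill`) is multiplicative in the
-- gaps, which yields a convolution recurrence for the single-gap counts, i.e. for
-- the dimensions (`Dimensions`).

open import Defs
open import Data.Nat using (ℕ; zero; suc)

module ListCounting where
  open import Data.Nat using (ℕ; zero; suc; _+_; _*_; _∸_)
  open import Data.Nat.Tactic.RingSolver using (solve-∀)
  open import Data.Bool using (Bool; true; false; if_then_else_)
  open import Data.Fin using (Fin)
  open import Data.Fin.Properties using (_≟_)
  open import Data.List using (List; []; _∷_; _++_; length; filter; map; concatMap; tabulate; allFin)
  open import Data.List.Properties using (map-tabulate; length-tabulate)
  open import Relation.Nullary using (does)
  open import Relation.Nullary.Decidable using (T?)
  open import Relation.Binary.PropositionalEquality

  count : {A : Set} → (A → Bool) → List A → ℕ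
  count p []       = 0
  count p (x ∷ xs) = if p x then suc (count p xs) else count p xs

  sumOver : {A : Set} → (A → ℕ) → List A → ℕ
  sumOver f []       = 0
  sumOver f (x ∷ xs) = f x + sumOver f xs

  length-filter : {A : Set} (p : A → Bool) (xs : List A) →
    length (filter (λ x → T? (p x)) xs) ≡ count p xs
  length-filter p [] = refl
  length-filter p (x ∷ xs) with p x
  ... | true  = cong suc (length-filter p xs)
  ... | false = length-filter p xs

  count-cong : {A : Set} {p q : A → Bool} (xs : List A) → (∀ x → p x ≡ q x) → count p xs ≡ count q xs
  count-cong [] eq = refl
  count-cong {q = q} (x ∷ xs) eq rewrite eq x with q x
  ... | true  = cong suc (count-cong xs eq)
  ... | false = count-cong xs eq

  count-none : {A : Set} (xs : List A) → count (λ _ → false) xs ≡ 0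
  count-none []       = refl
  count-none (x ∷ xs) = count-none xs

  count-++ : {A : Set} (p : A → Bool) (xs ys : List A) → count p (xs ++ ys) ≡ count p xs + count p ys
  count-++ p [] ys = refl
  count-++ p (x ∷ xs) ys with p x
  ... | true  = cong suc (count-++ p xs ys)
  ... | false = count-++ p xs ys

  count-map : {A B : Set} (p : B → Bool) (g : A → B) (xs : List A) →
    count p (map g xs) ≡ count (λ x → p (g x)) xs
  count-map p g [] = refl
  count-map p g (x ∷ xs) with p (g x)
  ... | true  = cong suc (count-map p g xs)
  ... | false = count-map p g xs

  count-concatMap : {A B : Set} (p : B → Bool) (g : A → List B) (xs : List A) →
    count p (concatMap g xs) ≡ sumOver (λ x → count p (g x)) xs
  count-concatMap p g [] = refl
  count-concatMap p g (x ∷ xs) =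
    trans (count-++ p (g x) (concatMap g xs)) (cong (count p (g x) +_) (count-concatMap p g xs))

  sumOver-cong : {A : Set} {f g : A → ℕ} (xs : List A) → (∀ x → f x ≡ g x) → sumOver f xs ≡ sumOver g xs
  sumOver-cong []       eq = refl
  sumOver-cong (x ∷ xs) eq = cong₂ _+_ (eq x) (sumOver-cong xs eq)

  sumOver-map : {A B : Set} (f : B → ℕ) (g : A → B) (xs : List A) →
    sumOver f (map g xs) ≡ sumOver (λ x → f (g x)) xs
  sumOver-map f g []       = refl
  sumOver-map f g (x ∷ xs) = cong (f (g x) +_) (sumOver-map f g xs)

  sumOver-const : {A : Set} (c : ℕ) (xs : List A) → sumOver (λ _ → c) xs ≡ length xs * c
  sumOver-const c []       = refl
  sumOver-const c (x ∷ xs) = cong (c +_) (sumOver-const c xs)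

  sumOver-tabulate-suc : (m : ℕ) (f : Fin (suc m) → ℕ) →
    sumOver f (tabulate {n = m} Fin.suc) ≡ sumOver (λ i → f (Fin.suc i)) (allFin m)
  sumOver-tabulate-suc m f =
    trans (cong (sumOver f) (sym (map-tabulate (λ i → i) Fin.suc))) (sumOver-map f Fin.suc (allFin m))

  sumOver-allFin-≟ : (m : ℕ) (j : Fin m) (h : Bool → ℕ) →
    sumOver (λ i → h (does (i ≟ j))) (allFin m) ≡ h true + (m ∸ 1) * h false
  sumOver-allFin-≟ (suc m) Fin.zero h = cong (h true +_) (begin
      sumOver (λ i → h (does (i ≟ Fin.zero))) (tabulate {n = m} Fin.suc)
    ≡⟨ sumOver-tabulate-suc m (λ i → h (does (i ≟ Fin.zero))) ⟩
      sumOver (λ _ → h false) (allFin m)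
    ≡⟨ sumOver-const (h false) (allFin m) ⟩
      length (allFin m) * h false
    ≡⟨ cong (_* h false) (length-tabulate {n = m} (λ i → i)) ⟩
      m * h false ∎)
    where open ≡-Reasoning
  sumOver-allFin-≟ (suc (suc m)) (Fin.suc j) h = begin
      h false + sumOver (λ i → h (does (i ≟ Fin.suc j))) (tabulate {n = suc m} Fin.suc)
    ≡⟨ cong (h false +_) (sumOver-tabulate-suc (suc m) (λ i → h (does (i ≟ Fin.suc j)))) ⟩
      h false + sumOver (λ i → h (does (i ≟ j))) (allFin (suc m))
    ≡⟨ cong (h false +_) (sumOver-allFin-≟ (suc m) j h) ⟩
      h false + (h true + m * h false)
    ≡⟨ swap (h false) (h true) (m * h false) ⟩
      h true + (h false + m * h false) ∎
    where
    open ≡-Reasoning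
    swap : ∀ a b c → a + (b + c) ≡ b + (a + c)
    swap = solve-∀

module Admissible where
  open import Data.Nat using (ℕ; zero; suc; _<ᵇ_)
  open import Data.Bool using (Bool; true; false; _∧_; _∨_; not)
  open import Data.Bool.Properties using (∧-assoc; ∧-idem; ∧-zeroʳ; ∨-comm)
  open import Data.List using (List; []; _∷_)
  open import Data.Product using (_×_; _,_)
  open import Relation.Binary.PropositionalEquality

  Arc : Set
  Arc = ℕ × ℕ

  <ᵇ-irrefl : ∀ x → (x <ᵇ x) ≡ false
  <ᵇ-irrefl zero          = refl
  <ᵇ-irrefl (suc zero)    = refl
  <ᵇ-irrefl (suc (suc x)) = <ᵇ-irrefl (suc x)

  crosses-irrefl : ∀ α → crosses α α ≡ false
  crosses-irrefl (x , y) rewrite <ᵇ-irrefl x = refl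

  crosses-sym : ∀ α β → crosses α β ≡ crosses β α
  crosses-sym (x , y) (x' , y') =
    ∨-comm ((x <ᵇ x') ∧ (x' <ᵇ y) ∧ (y <ᵇ y')) ((x' <ᵇ x) ∧ (x <ᵇ y') ∧ (y' <ᵇ y))

  allB-∧ : {A : Set} (p q : A → Bool) (ds : List A) → allB (λ d → p d ∧ q d) ds ≡ allB p ds ∧ allB q ds
  allB-∧ p q [] = refl
  allB-∧ p q (d ∷ ds) rewrite allB-∧ p q ds with p d | q d
  ... | true  | true  = refl
  ... | true  | false = sym (∧-zeroʳ (allB p ds))
  ... | false | _     = refl

  allB-cong : {A : Set} {p q : A → Bool} (ds : List A) → (∀ d → p d ≡ q d) → allB p ds ≡ allB q ds
  allB-cong []       eq = refl
  allB-cong (d ∷ ds) eq = cong₂ _∧_ (eq d) (allB-cong ds eq)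

  allB-true : {A : Set} (ds : List A) → allB (λ _ → true) ds ≡ true
  allB-true []       = refl
  allB-true (d ∷ ds) = allB-true ds

  pairwiseNoncrossing : List Arc → Bool
  pairwiseNoncrossing ds = allB (λ d → allB (λ d' → not (crosses d d')) ds) ds

  crossesNone : Arc → List Arc → Bool
  crossesNone α ds = allB (λ d → not (crosses α d)) ds

  admissible : (Arc → Bool) → List Arc → Bool
  admissible F ds = allB (λ d → not (F d)) ds ∧ pairwiseNoncrossing ds

  forbidAcross : (Arc → Bool) → Arc → (Arc → Bool)
  forbidAcross F α β = F β ∨ crosses α β

  pairwiseNoncrossing-cons : ∀ α ds →
    pairwiseNoncrossing (α ∷ ds) ≡ crossesNone α ds ∧ pairwiseNoncrossing ds
  pairwiseNoncrossing-cons α ds = begin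
      (not (crosses α α) ∧ crossesNone α ds)
        ∧ allB (λ d → not (crosses d α) ∧ allB (λ d' → not (crosses d d')) ds) ds
    ≡⟨ cong₂ (λ u v → (not u ∧ crossesNone α ds) ∧ v) (crosses-irrefl α)
             (allB-∧ (λ d → not (crosses d α)) _ ds) ⟩
      crossesNone α ds ∧ (allB (λ d → not (crosses d α)) ds ∧ pairwiseNoncrossing ds)
    ≡⟨ cong (λ u → crossesNone α ds ∧ (u ∧ pairwiseNoncrossing ds))
            (allB-cong ds (λ d → cong not (crosses-sym d α))) ⟩
      crossesNone α ds ∧ (crossesNone α ds ∧ pairwiseNoncrossing ds)
    ≡⟨ sym (∧-assoc (crossesNone α ds) _ _) ⟩
      (crossesNone α ds ∧ crossesNone α ds) ∧ pairwiseNoncrossing ds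
    ≡⟨ cong (_∧ pairwiseNoncrossing ds) (∧-idem (crossesNone α ds)) ⟩
      crossesNone α ds ∧ pairwiseNoncrossing ds ∎
    where open ≡-Reasoning

  avoids-forbidAcross : ∀ F α ds →
    allB (λ d → not (forbidAcross F α d)) ds ≡ allB (λ d → not (F d)) ds ∧ crossesNone α ds
  avoids-forbidAcross F α ds = trans (allB-cong ds (λ d → deMorgan (F d) (crosses α d))) (allB-∧ _ _ ds)
    where
    deMorgan : ∀ a b → not (a ∨ b) ≡ not a ∧ not b
    deMorgan true  b = refl
    deMorgan false b = refl

  admissible-cons : ∀ F α ds → admissible F (α ∷ ds) ≡ not (F α) ∧ admissible (forbidAcross F α) ds
  admissible-cons F α ds = begin
      (not (F α) ∧ allB (λ d → not (F d)) ds) ∧ pairwiseNoncrossing (α ∷ ds)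
    ≡⟨ cong ((not (F α) ∧ allB (λ d → not (F d)) ds) ∧_) (pairwiseNoncrossing-cons α ds) ⟩
      (not (F α) ∧ allB (λ d → not (F d)) ds) ∧ (crossesNone α ds ∧ pairwiseNoncrossing ds)
    ≡⟨ ∧-assoc (not (F α)) _ _ ⟩
      not (F α) ∧ (allB (λ d → not (F d)) ds ∧ (crossesNone α ds ∧ pairwiseNoncrossing ds))
    ≡⟨ cong (not (F α) ∧_) (sym (∧-assoc (allB (λ d → not (F d)) ds) _ _)) ⟩
      not (F α) ∧ ((allB (λ d → not (F d)) ds ∧ crossesNone α ds) ∧ pairwiseNoncrossing ds)
    ≡⟨ cong (λ u → not (F α) ∧ (u ∧ pairwiseNoncrossing ds)) (sym (avoids-forbidAcross F α ds)) ⟩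
      not (F α) ∧ admissible (forbidAcross F α) ds ∎
    where open ≡-Reasoning

module SequentialCount {m : ℕ} (M : FiniteUnitaryMagma m) where
  open FiniteUnitaryMagma M
  open ListCounting
  open Admissible
  open import Data.Nat using (ℕ; zero; suc; _+_; _*_; _∸_)
  open import Data.Bool using (Bool; true; false; _∧_; not; if_then_else_)
  open import Data.Fin using (Fin)
  open import Data.Fin.Properties using () renaming (_≟_ to _≟F_)
  open import Data.List using (List; []; _∷_; length; filter; map; concatMap; zip; allFin)
  open import Data.Vec as Vec using (toList)
  open import Data.Product using (proj₁; proj₂)
  open import Relation.Nullary using (does)
  open import Relation.Nullary.Decidable using (T?)
  open import Relation.Binary.PropositionalEquality

  w : ℕ
  w = m ∸ 1

  -- M has at least its unit, so m = 1 + w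
  m≡1+w : m ≡ suc w
  m≡1+w = nonempty (from 𝟙)
    where
    nonempty : Fin m → m ≡ suc (m ∸ 1)
    nonempty Fin.zero    = refl
    nonempty (Fin.suc _) = refl

  sumOver-elements : (h : Bool → ℕ) → sumOver (λ a → h (isUnit a)) elements ≡ h true + w * h false
  sumOver-elements h = begin
      sumOver (λ a → h (isUnit a)) (map to (allFin m))
    ≡⟨ sumOver-map (λ a → h (isUnit a)) to (allFin m) ⟩
      sumOver (λ i → h (isUnit (to i))) (allFin m)
    ≡⟨ sumOver-cong (allFin m) (λ i → cong (λ j → h (does (j ≟F from 𝟙))) (strictlyInverseʳ i)) ⟩
      sumOver (λ i → h (does (i ≟F from 𝟙))) (allFin m)
    ≡⟨ sumOver-allFin-≟ m (from 𝟙) h ⟩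
      h true + w * h false ∎
    where open ≡-Reasoning

  module _ (n : ℕ) where
    solidDiagonalsOf : List Arc → List Carrier → List Arc
    solidDiagonalsOf as ls =
      map proj₁ (filter (λ p → T? (isDiagonal n (proj₁ p) ∧ not (isUnit (proj₂ p)))) (zip as ls))

    -- Number of labelings of the arcs `as` (in a clique of size n) whose solid
    -- diagonals are admissible for F, computed arc by arc: a non-diagonal takes
    -- any of the m labels; a diagonal is the unit, or one of w solid labels if it
    -- is not forbidden, after which every arc crossing it is forbidden.
    labelings : List Arc → (Arc → Bool) → ℕ
    labelings []       F = 1
    labelings (α ∷ as) F =
      if isDiagonal n α
      then labelings as F + w * (if F α then 0 else labelings as (forbidAcross F α))
      else m * labelings as F

    count-admissible : ∀ as F →
      count (λ c → admissible F (solidDiagonalsOf as (toList c))) (allVecs M (length as)) ≡ labelings as F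
    count-admissible []       F = refl
    count-admissible (α ∷ as) F = begin
        count admissibleAll (concatMap (λ a → map (a Vec.∷_) vecs) elements)
      ≡⟨ count-concatMap admissibleAll (λ a → map (a Vec.∷_) vecs) elements ⟩
        sumOver (λ a → count admissibleAll (map (a Vec.∷_) vecs)) elements
      ≡⟨ sumOver-cong elements (λ a → trans (count-map admissibleAll (a Vec.∷_) vecs) (by-first-label a)) ⟩
        sumOver (λ a → byUnit (isDiagonal n α) (isUnit a)) elements
      ≡⟨ sumOver-elements (byUnit (isDiagonal n α)) ⟩
        byUnit (isDiagonal n α) true + w * byUnit (isDiagonal n α) false
      ≡⟨ total (isDiagonal n α) refl ⟩
        labelings (α ∷ as) F ∎
      where
      open ≡-Reasoning
      vecs = allVecs M (length as)
      admissibleAll = λ c → admissible F (solidDiagonalsOf (α ∷ as) (toList c))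
      byUnit : Bool → Bool → ℕ
      byUnit _     true  = labelings as F
      byUnit false false = labelings as F
      byUnit true  false = if F α then 0 else labelings as (forbidAcross F α)
      solid : ∀ b → F α ≡ b →
        count (λ c → not b ∧ admissible (forbidAcross F α) (solidDiagonalsOf as (toList c))) vecs
        ≡ (if b then 0 else labelings as (forbidAcross F α))
      solid true  _ = count-none vecs
      solid false _ = count-admissible as (forbidAcross F α)
      by-first-label : ∀ a →
        count (λ c → admissible F (solidDiagonalsOf (α ∷ as) (a ∷ toList c))) vecs ≡ byUnit (isDiagonal n α) (isUnit a)
      by-first-label a with isDiagonal n α | isUnit a
      ... | false | true  = count-admissible as F
      ... | false | false = count-admissible as F
      ... | true  | true  = count-admissible as F
      ... | true  | false = trans (count-cong vecs (λ c → admissible-cons F α (solidDiagonalsOf as (toList c))))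
                                  (solid (F α) refl)
      total : ∀ d → isDiagonal n α ≡ d → byUnit d true + w * byUnit d false ≡ labelings (α ∷ as) F
      total true  eq rewrite eq = refl
      total false eq rewrite eq = cong (_* labelings as F) (sym m≡1+w)

  dimNC≡labelings : ∀ k → let n = suc (suc k) in dimNC M n ≡ labelings n (arcs n) (λ _ → false)
  dimNC≡labelings k = begin
      length (filter (λ c → T? (noncrossing M n c)) vecs)
    ≡⟨ length-filter (noncrossing M n) vecs ⟩
      count (noncrossing M n) vecs
    ≡⟨ count-cong vecs (λ c → sym (cong (_∧ pairwiseNoncrossing (solidDiagonals M n c))
                                         (allB-true (solidDiagonals M n c)))) ⟩
      count (λ c → admissible (λ _ → false) (solidDiagonalsOf n (arcs n) (toList c))) vecs
    ≡⟨ count-admissible n (arcs n) (λ _ → false) ⟩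
      labelings n (arcs n) (λ _ → false) ∎
    where
    open ≡-Reasoning
    n = suc (suc k)
    vecs = allVecs M (nArcs n)

module ArcRows where
  open Admissible using (Arc)
  open import Data.Nat using (ℕ; zero; suc; _+_; _∸_; _≤_; _<_; s≤s)
  open import Data.Nat.Properties using (+-suc; +-identityʳ; ≤-refl; ≤-reflexive; ≤-trans; ≤-pred; <⇒≤; m≤m+n)
  open import Data.List using (List; []; _∷_; _++_; map; concat; applyUpTo; upTo)
  open import Data.List.Properties using (map-upTo)
  open import Data.List.Relation.Unary.All as All using (All; []; _∷_)
  open import Data.List.Relation.Unary.All.Properties using (++⁺)
  open import Data.Product using (_×_; _,_; proj₁; proj₂)
  open import Relation.Binary.PropositionalEquality

  row : ℕ → ℕ → ℕ → List Arc
  row x y zero    = []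
  row x y (suc j) = (x , y) ∷ row x (suc y) j

  rows : ℕ → ℕ → List Arc
  rows x zero    = []
  rows x (suc k) = row x (suc x) (suc k) ++ rows (suc x) k

  applyUpTo-row : ∀ x y j (g : ℕ → Arc) → (∀ d → g d ≡ (x , y + d)) → applyUpTo g j ≡ row x y j
  applyUpTo-row x y zero    g eq = refl
  applyUpTo-row x y (suc j) g eq =
    cong₂ _∷_ (trans (eq 0) (cong (x ,_) (+-identityʳ y)))
              (applyUpTo-row x (suc y) j (λ d → g (suc d)) (λ d → trans (eq (suc d)) (cong (x ,_) (+-suc y d))))

  concat-applyUpTo-rows : ∀ x k (g : ℕ → List Arc) → (∀ i → g i ≡ row (x + i) (suc (x + i)) (k ∸ i)) →
    concat (applyUpTo g k) ≡ rows x k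
  concat-applyUpTo-rows x zero    g eq = refl
  concat-applyUpTo-rows x (suc k) g eq = cong₂ _++_
    (trans (eq 0) (cong (λ a → row a (suc a) (suc k)) (+-identityʳ x)))
    (concat-applyUpTo-rows (suc x) k (λ i → g (suc i))
      (λ i → trans (eq (suc i)) (cong (λ a → row a (suc a) (k ∸ i)) (+-suc x i))))

  arcs≡rows : ∀ n → arcs n ≡ rows 1 n
  arcs≡rows n = begin
      concat (map arcsFrom (upTo n))
    ≡⟨ cong concat (map-upTo arcsFrom n) ⟩
      concat (applyUpTo arcsFrom n)
    ≡⟨ concat-applyUpTo-rows 1 n arcsFrom isRow ⟩
      rows 1 n ∎
    where
    open ≡-Reasoning
    arcsFrom : ℕ → List Arc
    arcsFrom x = map (λ d → (suc x , suc x + suc d)) (upTo (n ∸ x))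
    isRow : ∀ x → arcsFrom x ≡ row (suc x) (suc (suc x)) (n ∸ x)
    isRow x = trans (map-upTo (λ d → (suc x , suc x + suc d)) (n ∸ x))
                    (applyUpTo-row (suc x) (suc (suc x)) (n ∸ x) _ (λ d → cong (suc x ,_) (+-suc (suc x) d)))

  row-bounds : ∀ x y j → All (λ α → proj₁ α ≡ x × y ≤ proj₂ α × proj₂ α < y + j) (row x y j)
  row-bounds x y zero    = []
  row-bounds x y (suc j) = (refl , ≤-refl , lt) ∷ All.map shift (row-bounds x (suc y) j)
    where
    lt : y < y + suc j
    lt = ≤-trans (s≤s (m≤m+n y j)) (≤-reflexive (sym (+-suc y j)))
    shift : ∀ {α} → proj₁ α ≡ x × suc y ≤ proj₂ α × proj₂ α < suc y + j →
                    proj₁ α ≡ x × y ≤ proj₂ α × proj₂ α < y + suc j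
    shift (e , p , q) rewrite +-suc y j = e , <⇒≤ p , q

  rows-bounds : ∀ x k → All (λ α → x ≤ proj₁ α × proj₂ α ≤ x + k) (rows x k)
  rows-bounds x zero    = []
  rows-bounds x (suc k) = ++⁺ (All.map first (row-bounds x (suc x) (suc k))) (All.map later (rows-bounds (suc x) k))
    where
    first : ∀ {α} → proj₁ α ≡ x × suc x ≤ proj₂ α × proj₂ α < suc x + suc k →
                    x ≤ proj₁ α × proj₂ α ≤ x + suc k
    first (refl , _ , q) rewrite +-suc x k = ≤-refl , ≤-pred q
    later : ∀ {α} → suc x ≤ proj₁ α × proj₂ α ≤ suc x + k → x ≤ proj₁ α × proj₂ α ≤ x + suc k
    later (p , q) rewrite +-suc x k = <⇒≤ p , q

module Convolution where
  open import Data.Nat using (ℕ; zero; suc; _+_; _*_)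
  open import Data.Nat.Properties using (*-zeroʳ; *-distribˡ-+; +-identityʳ; +-assoc)
  open import Data.Nat.Tactic.RingSolver using (solve-∀)
  open import Relation.Binary.PropositionalEquality

  conv : (ℕ → ℕ) → (ℕ → ℕ) → ℕ → ℕ
  conv f h zero    = 0
  conv f h (suc q) = f 0 * h q + conv (λ i → f (suc i)) h q

  conv-cong : ∀ q {f f' h h' : ℕ → ℕ} → (∀ i → f i ≡ f' i) → (∀ i → h i ≡ h' i) → conv f h q ≡ conv f' h' q
  conv-cong zero    ef eh = refl
  conv-cong (suc q) ef eh = cong₂ _+_ (cong₂ _*_ (ef 0) (eh q)) (conv-cong q (λ i → ef (suc i)) eh)

  conv-scale : ∀ c q (f h : ℕ → ℕ) → c * conv f h q ≡ conv f (λ i → c * h i) q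
  conv-scale c zero    f h = *-zeroʳ c
  conv-scale c (suc q) f h = trans (*-distribˡ-+ c (f 0 * h q) _)
    (cong₂ _+_ (swap c (f 0) (h q)) (conv-scale c q (λ i → f (suc i)) h))
    where
    swap : ∀ c a b → c * (a * b) ≡ a * (c * b)
    swap = solve-∀

  conv-last : ∀ q (f h : ℕ → ℕ) → conv f h (suc q) ≡ conv f (λ i → h (suc i)) q + f q * h 0
  conv-last zero    f h = +-identityʳ (f 0 * h 0)
  conv-last (suc q) f h = trans (cong (f 0 * h (suc q) +_) (conv-last q (λ i → f (suc i)) h))
                                (sym (+-assoc (f 0 * h (suc q)) _ _))

-- The number of ways to complete a clique row by row, as a function of the
-- vertices marked by the solid diagonals of earlier rows (see `RowByRow`).
-- A list of gaps ℓ₁ ∷ ℓ₂ ∷ … seen from a vertex x marks the vertices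
-- x + (ℓ₁+1), x + (ℓ₁+1) + (ℓ₂+1), …; an arc is forbidden exactly when a marked
-- vertex lies strictly inside it.
module GapCounts (m w : ℕ) where
  open Convolution
  open import Data.Nat using (zero; suc; _+_; _*_)
  open import Data.Nat.Properties using (+-identityʳ; +-suc; +-assoc; *-zeroʳ; suc-injective; *-assoc; *-distribʳ-+)
  open import Data.Nat.Tactic.RingSolver using (solve-∀)
  open import Data.List using (List; []; _∷_; _++_)
  open import Data.List.Properties using (++-assoc)
  open import Relation.Binary.PropositionalEquality

  gapSum : List ℕ → ℕ
  gapSum []      = 0
  gapSum (ℓ ∷ L) = suc ℓ + gapSum L

  gapSum-++ : ∀ L₁ L₂ → gapSum (L₁ ++ L₂) ≡ gapSum L₁ + gapSum L₂
  gapSum-++ []       L₂ = refl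
  gapSum-++ (ℓ ∷ L₁) L₂ = trans (cong (suc ℓ +_) (gapSum-++ L₁ L₂)) (sym (+-assoc (suc ℓ) (gapSum L₁) (gapSum L₂)))

  mutual
    -- fill k L : completions of the last k rows with marked vertices L (gapSum L = k;
    -- other states do not occur).  The first row starts with an edge (m labels); if
    -- the next vertex is marked nothing else in the row is allowed, otherwise the row
    -- continues along the first gap.
    fill : ℕ → List ℕ → ℕ
    fill _       []            = 1
    fill zero    (_ ∷ _)       = 0
    fill (suc s) (zero  ∷ L)   = m * fill s L
    fill (suc s) (suc ℓ ∷ L)   = m * fillRow s [] 0 ℓ L

    -- fillRow s acc p q L : walking along the first gap, with q diagonals before the
    -- first marked vertex still to decide; acc are the gaps already cut off by solid
    -- diagonals of this row and p the distance since the last one.  A diagonal is the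
    -- unit (the gap grows) or one of w solid labels (a new marked vertex); the arc to
    -- the marked vertex takes any of m labels and ends the row.
    fillRow : ℕ → List ℕ → ℕ → ℕ → List ℕ → ℕ
    fillRow s acc p zero    L = m * fill s (acc ++ p ∷ L)
    fillRow s acc p (suc q) L = fillRow s acc (suc p) q L + w * fillRow s (acc ++ p ∷ []) 0 q L

  -- Marked vertices separate the polygon, so counts multiply along a split of the gaps.
  mutual
    fill-++ : ∀ s₁ L₁ s₂ L₂ → gapSum L₁ ≡ s₁ → fill (s₁ + s₂) (L₁ ++ L₂) ≡ fill s₁ L₁ * fill s₂ L₂
    fill-++ zero     []           s₂ L₂ e  = sym (+-identityʳ (fill s₂ L₂))
    fill-++ (suc s₁) []           s₂ L₂ ()
    fill-++ zero     (ℓ ∷ L₁)     s₂ L₂ ()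
    fill-++ (suc s₁) (zero ∷ L₁)  s₂ L₂ e  =
      trans (cong (m *_) (fill-++ s₁ L₁ s₂ L₂ (suc-injective e))) (sym (*-assoc m _ _))
    fill-++ (suc s₁) (suc ℓ ∷ L₁) s₂ L₂ e  =
      trans (cong (m *_) (fillRow-++ s₁ [] 0 ℓ L₁ s₂ L₂ (suc-injective e))) (sym (*-assoc m _ _))

    fillRow-++ : ∀ s₁ acc p q L₁ s₂ L₂ → gapSum acc + suc p + q + gapSum L₁ ≡ s₁ →
      fillRow (s₁ + s₂) acc p q (L₁ ++ L₂) ≡ fillRow s₁ acc p q L₁ * fill s₂ L₂
    fillRow-++ s₁ acc p zero L₁ s₂ L₂ e = begin
        m * fill (s₁ + s₂) (acc ++ p ∷ L₁ ++ L₂)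
      ≡⟨ cong (λ L → m * fill (s₁ + s₂) L) (sym (++-assoc acc (p ∷ L₁) L₂)) ⟩
        m * fill (s₁ + s₂) ((acc ++ p ∷ L₁) ++ L₂)
      ≡⟨ cong (m *_) (fill-++ s₁ (acc ++ p ∷ L₁) s₂ L₂
                               (trans (gapSum-++ acc (p ∷ L₁)) (trans (shape (gapSum acc) p (gapSum L₁)) e))) ⟩
        m * (fill s₁ (acc ++ p ∷ L₁) * fill s₂ L₂)
      ≡⟨ sym (*-assoc m _ _) ⟩
        m * fill s₁ (acc ++ p ∷ L₁) * fill s₂ L₂ ∎
      where
      open ≡-Reasoning
      shape : ∀ a p r → a + (suc p + r) ≡ a + suc p + 0 + r
      shape = solve-∀
    fillRow-++ s₁ acc p (suc q) L₁ s₂ L₂ e = begin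
        fillRow (s₁ + s₂) acc (suc p) q (L₁ ++ L₂) + w * fillRow (s₁ + s₂) (acc ++ p ∷ []) 0 q (L₁ ++ L₂)
      ≡⟨ cong₂ (λ u v → u + w * v)
               (fillRow-++ s₁ acc (suc p) q L₁ s₂ L₂ (trans (unitShape (gapSum acc) p q (gapSum L₁)) e))
                                    (fillRow-++ s₁ (acc ++ p ∷ []) 0 q L₁ s₂ L₂ solidSum) ⟩
        fillRow s₁ acc (suc p) q L₁ * fill s₂ L₂ + w * (fillRow s₁ (acc ++ p ∷ []) 0 q L₁ * fill s₂ L₂)
      ≡⟨ cong (fillRow s₁ acc (suc p) q L₁ * fill s₂ L₂ +_) (sym (*-assoc w _ (fill s₂ L₂))) ⟩
        fillRow s₁ acc (suc p) q L₁ * fill s₂ L₂ + w * fillRow s₁ (acc ++ p ∷ []) 0 q L₁ * fill s₂ L₂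
      ≡⟨ sym (*-distribʳ-+ (fill s₂ L₂) (fillRow s₁ acc (suc p) q L₁) (w * fillRow s₁ (acc ++ p ∷ []) 0 q L₁)) ⟩
        fillRow s₁ acc p (suc q) L₁ * fill s₂ L₂ ∎
      where
      open ≡-Reasoning
      unitShape : ∀ a p q r → a + suc (suc p) + q + r ≡ a + suc p + suc q + r
      unitShape = solve-∀
      solidShape : ∀ a p q r → a + (suc p + 0) + 1 + q + r ≡ a + suc p + suc q + r
      solidShape = solve-∀
      solidSum : gapSum (acc ++ p ∷ []) + 1 + q + gapSum L₁ ≡ s₁
      solidSum = trans (cong (λ g → g + 1 + q + gapSum L₁) (gapSum-++ acc (p ∷ [])))
                       (trans (solidShape (gapSum acc) p q (gapSum L₁)) e)

  fillRow-acc : ∀ sa A s acc p q L → gapSum A ≡ sa →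
    fillRow (sa + s) (A ++ acc) p q L ≡ fill sa A * fillRow s acc p q L
  fillRow-acc sa A s acc p zero L e = begin
      m * fill (sa + s) ((A ++ acc) ++ p ∷ L)
    ≡⟨ cong (λ L′ → m * fill (sa + s) L′) (++-assoc A acc (p ∷ L)) ⟩
      m * fill (sa + s) (A ++ acc ++ p ∷ L)
    ≡⟨ cong (m *_) (fill-++ sa A s (acc ++ p ∷ L) e) ⟩
      m * (fill sa A * fill s (acc ++ p ∷ L))
    ≡⟨ swap m (fill sa A) _ ⟩
      fill sa A * (m * fill s (acc ++ p ∷ L)) ∎
    where
    open ≡-Reasoning
    swap : ∀ a b c → a * (b * c) ≡ b * (a * c)
    swap = solve-∀
  fillRow-acc sa A s acc p (suc q) L e = begin
      fillRow (sa + s) (A ++ acc) (suc p) q L + w * fillRow (sa + s) ((A ++ acc) ++ p ∷ []) 0 q L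
    ≡⟨ cong₂ (λ u v → u + w * v) (fillRow-acc sa A s acc (suc p) q L e)
         (trans (cong (λ A′ → fillRow (sa + s) A′ 0 q L) (++-assoc A acc (p ∷ [])))
                (fillRow-acc sa A s (acc ++ p ∷ []) 0 q L e)) ⟩
      fill sa A * fillRow s acc (suc p) q L + w * (fill sa A * fillRow s (acc ++ p ∷ []) 0 q L)
    ≡⟨ factor (fill sa A) (fillRow s acc (suc p) q L) w (fillRow s (acc ++ p ∷ []) 0 q L) ⟩
      fill sa A * fillRow s acc p (suc q) L ∎
    where
    open ≡-Reasoning
    factor : ∀ a u w v → a * u + w * (a * v) ≡ a * (u + w * v)
    factor = solve-∀

  -- the count for a polygon in which only the last vertex is marked (a single gap of length l)
  single : ℕ → ℕ
  single l = fill (suc l) (l ∷ [])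

  walkSingle : ℕ → ℕ → ℕ
  walkSingle p q = fillRow (suc p + q) [] p q []

  -- Unrolling the walk: either all remaining diagonals are the unit, or the first
  -- solid one, after i further steps, cuts off a single gap of length p+i.
  walkSingle-unroll : ∀ q p →
    walkSingle p q ≡ m * single (p + q) + w * conv (λ i → single (p + i)) (walkSingle 0) q
  walkSingle-unroll zero p rewrite +-identityʳ p | *-zeroʳ w = sym (+-identityʳ (m * single p))
  walkSingle-unroll (suc q) p = begin
      fillRow (suc p + suc q) [] (suc p) q [] + w * fillRow (suc p + suc q) (p ∷ []) 0 q []
    ≡⟨ cong₂ (λ u v → u + w * v) (cong (λ s → fillRow s [] (suc p) q []) (+-suc (suc p) q))
                                  (fillRow-acc (suc p) (p ∷ []) (suc q) [] 0 q [] (+-identityʳ (suc p))) ⟩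
      walkSingle (suc p) q + w * (single p * walkSingle 0 q)
    ≡⟨ cong (_+ w * (single p * walkSingle 0 q)) (walkSingle-unroll q (suc p)) ⟩
      m * single (suc p + q) + w * conv (λ i → single (suc p + i)) (walkSingle 0) q + w * (single p * walkSingle 0 q)
    ≡⟨ rearrange m w (single (suc p + q)) (conv (λ i → single (suc p + i)) (walkSingle 0) q) (single p * walkSingle 0 q) ⟩
      m * single (suc p + q) + w * (single p * walkSingle 0 q + conv (λ i → single (suc p + i)) (walkSingle 0) q)
    ≡⟨ cong₂ (λ a c → m * single a + w * (single p * walkSingle 0 q + c)) (sym (+-suc p q))
             (conv-cong q (λ i → cong single (sym (+-suc p i))) (λ _ → refl)) ⟩
      m * single (p + suc q) + w * (single p * walkSingle 0 q + conv (λ i → single (p + suc i)) (walkSingle 0) q)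
    ≡⟨ cong (λ a → m * single (p + suc q) + w * (single a * walkSingle 0 q + conv (λ i → single (p + suc i)) (walkSingle 0) q))
            (sym (+-identityʳ p)) ⟩
      m * single (p + suc q) + w * conv (λ i → single (p + i)) (walkSingle 0) (suc q) ∎
    where
    open ≡-Reasoning
    rearrange : ∀ m w a c y → m * a + w * c + w * y ≡ m * a + w * (y + c)
    rearrange = solve-∀

  single-recurrence : ∀ l →
    single (suc (suc l)) ≡ m * m * single (suc l) + w * conv single (λ i → single (suc i)) (suc l)
  single-recurrence l = begin
      m * walkSingle 0 (suc l)
    ≡⟨ cong (m *_) (walkSingle-unroll (suc l) 0) ⟩
      m * (m * single (suc l) + w * conv single (walkSingle 0) (suc l))
    ≡⟨ distribute m w (single (suc l)) (conv single (walkSingle 0) (suc l)) ⟩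
      m * m * single (suc l) + w * (m * conv single (walkSingle 0) (suc l))
    ≡⟨ cong (λ c → m * m * single (suc l) + w * c) (conv-scale m (suc l) single (walkSingle 0)) ⟩
      m * m * single (suc l) + w * conv single (λ i → single (suc i)) (suc l) ∎
    where
    open ≡-Reasoning
    distribute : ∀ m w a c → m * (m * a + w * c) ≡ m * m * a + w * (m * c)
    distribute = solve-∀

-- Counting the labelings of a clique of size n row by row: after the rows of the
-- vertices before x, the forbidden arcs among the remaining rows are exactly those
-- with a marked vertex inside, the marked vertices being the far ends of the solid
-- diagonals chosen so far.  This identifies the count with `fill`.
module RowByRow {m : ℕ} (M : FiniteUnitaryMagma m) (n : ℕ) where
  open Admissible using (Arc; <ᵇ-irrefl; forbidAcross)
  open SequentialCount M using (w; m≡1+w; labelings)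
  open GapCounts m w
  open ArcRows
  open import Data.Nat using (zero; suc; _+_; _*_; _≤_; _<_; s≤s; z≤n; _<ᵇ_; _≡ᵇ_)
  open import Data.Nat.Properties
    using (+-suc; +-identityʳ; +-assoc; +-comm; +-cancelˡ-≡; *-zeroʳ; suc-injective;
           n≤1+n; ≤-refl; ≤-reflexive; ≤-trans; ≤-pred; <⇒≤; m≤m+n; m<m+n)
  open import Data.Nat.Tactic.RingSolver using (solve-∀)
  open import Data.Bool using (Bool; true; false; _∧_; _∨_; not; if_then_else_)
  open import Data.Bool.Properties using (∧-zeroʳ; ∨-identityʳ; ∨-comm; ∨-assoc)
  open import Data.List using (List; []; _∷_; _++_)
  open import Data.List.Relation.Unary.All as All using (All; []; _∷_)
  open import Data.List.Relation.Unary.All.Properties using (++⁺)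
  open import Data.Product using (_×_; _,_; proj₁; proj₂)
  open import Data.Sum using (_⊎_; inj₁; inj₂)
  open import Relation.Binary.PropositionalEquality

  <ᵇ-true : ∀ {a b} → a < b → (a <ᵇ b) ≡ true
  <ᵇ-true {zero}  {suc b} _         = refl
  <ᵇ-true {suc a} {suc b} (s≤s a<b) = <ᵇ-true a<b

  <ᵇ-false : ∀ {a b} → b ≤ a → (a <ᵇ b) ≡ false
  <ᵇ-false {a}     {zero}  _         = refl
  <ᵇ-false {suc a} {suc b} (s≤s b≤a) = <ᵇ-false b≤a

  ≡ᵇ-false : ∀ {a b} → a < b → (a ≡ᵇ b) ≡ false
  ≡ᵇ-false {zero}  {suc b} _         = refl
  ≡ᵇ-false {suc a} {suc b} (s≤s a<b) = ≡ᵇ-false a<b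

  isDiagonal-edge : ∀ x → isDiagonal n (x , suc x) ≡ false
  isDiagonal-edge x rewrite <ᵇ-irrefl (suc x) = refl

  isDiagonal-inner : ∀ x b → suc x < b → 2 ≤ x ⊎ b ≤ n → isDiagonal n (x , b) ≡ true
  isDiagonal-inner x b x+1<b notBase rewrite <ᵇ-true x+1<b = cong not (notBase′ notBase)
    where
    notBase′ : 2 ≤ x ⊎ b ≤ n → ((x ≡ᵇ 1) ∧ (b ≡ᵇ suc n)) ≡ false
    notBase′ (inj₁ (s≤s (s≤s _))) = refl
    notBase′ (inj₂ b≤n) rewrite ≡ᵇ-false {b} (s≤s b≤n) = ∧-zeroʳ (x ≡ᵇ 1)

  labelings-cong : ∀ as {F G} (P : Arc → Set) → All P as → (∀ α → P α → F α ≡ G α) →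
    labelings n as F ≡ labelings n as G
  labelings-cong []       P []         eq = refl
  labelings-cong (α ∷ as) {F} {G} P (pα ∷ ps) eq rewrite eq α pα =
    cong₂ (λ u v → if isDiagonal n α then u + w * (if G α then 0 else v) else m * u)
          (labelings-cong as P ps eq)
          (labelings-cong as P ps (λ β pβ → cong (_∨ crosses α β) (eq β pβ)))

  -- forbidden diagonals can only be the unit
  labelings-forbidden : ∀ as bs F → All (λ α → isDiagonal n α ≡ true × F α ≡ true) as →
    labelings n (as ++ bs) F ≡ labelings n bs F
  labelings-forbidden []       bs F []                = refl
  labelings-forbidden (α ∷ as) bs F ((d , f) ∷ forced) rewrite d | f =
    trans (cong (labelings n (as ++ bs) F +_) (*-zeroʳ w))
          (trans (+-identityʳ _) (labelings-forbidden as bs F forced))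

  labelings-open : ∀ α as F → isDiagonal n α ≡ true → F α ≡ false →
    labelings n (α ∷ as) F ≡ labelings n as F + w * labelings n as (forbidAcross F α)
  labelings-open α as F isD notF rewrite isD | notF = refl

  markedInside : ℕ → List ℕ → ℕ → ℕ → Bool
  markedInside p []      a b = false
  markedInside p (ℓ ∷ L) a b = ((a <ᵇ (p + suc ℓ)) ∧ ((p + suc ℓ) <ᵇ b)) ∨ markedInside (p + suc ℓ) L a b

  markedInside-++ : ∀ p L₁ L₂ a b →
    markedInside p (L₁ ++ L₂) a b ≡ markedInside p L₁ a b ∨ markedInside (p + gapSum L₁) L₂ a b
  markedInside-++ p []       L₂ a b = cong (λ q → markedInside q L₂ a b) (sym (+-identityʳ p))
  markedInside-++ p (ℓ ∷ L₁) L₂ a b = begin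
      inside (p + suc ℓ) ∨ markedInside (p + suc ℓ) (L₁ ++ L₂) a b
    ≡⟨ cong (inside (p + suc ℓ) ∨_) (markedInside-++ (p + suc ℓ) L₁ L₂ a b) ⟩
      inside (p + suc ℓ) ∨ (markedInside (p + suc ℓ) L₁ a b ∨ markedInside (p + suc ℓ + gapSum L₁) L₂ a b)
    ≡⟨ sym (∨-assoc (inside (p + suc ℓ)) _ _) ⟩
      markedInside p (ℓ ∷ L₁) a b ∨ markedInside (p + suc ℓ + gapSum L₁) L₂ a b
    ≡⟨ cong (λ q → markedInside p (ℓ ∷ L₁) a b ∨ markedInside q L₂ a b) (+-assoc p (suc ℓ) (gapSum L₁)) ⟩
      markedInside p (ℓ ∷ L₁) a b ∨ markedInside (p + gapSum (ℓ ∷ L₁)) L₂ a b ∎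
    where
    open ≡-Reasoning
    inside : ℕ → Bool
    inside v = (a <ᵇ v) ∧ (v <ᵇ b)

  -- all marked vertices lie after p, so none is inside an arc ending by p
  markedInside-before : ∀ p L a b → b ≤ p → markedInside p L a b ≡ false
  markedInside-before p []      a b b≤p = refl
  markedInside-before p (ℓ ∷ L) a b b≤p
    rewrite <ᵇ-false {p + suc ℓ} {b} (≤-trans b≤p (m≤m+n p (suc ℓ))) | ∧-zeroʳ (a <ᵇ (p + suc ℓ)) =
    markedInside-before (p + suc ℓ) L a b (≤-trans b≤p (m≤m+n p (suc ℓ)))

  Agree : ℕ → List ℕ → (Arc → Bool) → Set
  Agree x L F = ∀ a b → x ≤ a → b ≤ suc n → F (a , b) ≡ markedInside x L a b

  InRows : ℕ → Arc → Set
  InRows x α = x ≤ proj₁ α × proj₂ α ≤ suc n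

  rows-InRows : ∀ x k → x + k ≡ suc n → All (InRows x) (rows x k)
  rows-InRows x k ends = All.map (λ (p , q) → p , ≤-trans q (≤-reflexive ends)) (rows-bounds x k)

  -- Row x when its first gap is nonempty, the first marked vertex being t = x + ℓ + 2;
  -- `next` counts the rows after x.
  module Walk (x ℓ k : ℕ) (rest : List ℕ)
              (ends : x + suc (suc ℓ) + gapSum rest ≡ suc n)
              (sizes : suc ℓ + gapSum rest ≡ k)
              (baseSafe : 2 ≤ x ⊎ rest ≡ [])
              (next : ∀ L F → gapSum L ≡ k → Agree (suc x) L F → labelings n (rows (suc x) k) F ≡ fill k L)
              where
    L : List ℕ
    L = suc ℓ ∷ rest

    t : ℕ
    t = x + suc (suc ℓ)

    x<t : x < t
    x<t = m<m+n x (s≤s z≤n)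

    t≤n+1 : t ≤ suc n
    t≤n+1 = ≤-trans (m≤m+n t (gapSum rest)) (≤-reflexive ends)

    later-rows-end : suc x + k ≡ suc n
    later-rows-end = trans (cong (suc x +_) (sym sizes)) (trans (shape x ℓ (gapSum rest)) ends)
      where
      shape : ∀ x l r → suc x + (suc l + r) ≡ x + suc (suc l) + r
      shape = solve-∀

    -- While walking along the first gap, F forbids what L forbids and, in the later
    -- rows only, what the vertices cut off by the solid diagonals of row x forbid.
    WalkAgree : List ℕ → (Arc → Bool) → Set
    WalkAgree acc F = ∀ a b → x ≤ a → b ≤ suc n →
      F (a , b) ≡ markedInside x L a b ∨ ((x <ᵇ a) ∧ markedInside (suc x) acc a b)

    walkAgree-start : ∀ {F} → Agree x L F → WalkAgree [] F
    walkAgree-start ag a b x≤a b≤n+1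
      rewrite ∧-zeroʳ (x <ᵇ a) | ∨-identityʳ (markedInside x L a b) = ag a b x≤a b≤n+1

    -- a solid diagonal (x , Y) marks Y for the later rows
    walkAgree-cut : ∀ acc {p Y F} → suc x + gapSum acc + suc p ≡ Y → WalkAgree acc F →
      WalkAgree (acc ++ p ∷ []) (forbidAcross F (x , Y))
    walkAgree-cut acc {p} {Y} pos ag a b x≤a b≤n+1 rewrite ag a b x≤a b≤n+1 | <ᵇ-false {a} {x} x≤a =
      trans (regroup (markedInside x L a b) (x <ᵇ a) (markedInside (suc x) acc a b) (a <ᵇ Y) (Y <ᵇ b))
            (cong (λ c → markedInside x L a b ∨ ((x <ᵇ a) ∧ c)) (sym cutOff))
      where
      regroup : ∀ C X A P Q → (C ∨ (X ∧ A)) ∨ ((X ∧ (P ∧ Q)) ∨ false) ≡ C ∨ (X ∧ (A ∨ ((P ∧ Q) ∨ false)))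
      regroup true  X     A     P     Q     = refl
      regroup false false A     P     Q     = refl
      regroup false true  true  P     Q     = refl
      regroup false true  false false Q     = refl
      regroup false true  false true  false = refl
      regroup false true  false true  true  = refl
      cutOff : markedInside (suc x) (acc ++ p ∷ []) a b ≡ markedInside (suc x) acc a b ∨ (((a <ᵇ Y) ∧ (Y <ᵇ b)) ∨ false)
      cutOff = trans (markedInside-++ (suc x) acc (p ∷ []) a b)
                     (cong (λ v → markedInside (suc x) acc a b ∨ (((a <ᵇ v) ∧ (v <ᵇ b)) ∨ false)) pos)

    -- reaching t, the vertices cut off in row x become the first gaps of the next row
    walkAgree-next : ∀ acc {p F} → suc x + gapSum acc + suc p ≡ t → WalkAgree acc F → Agree (suc x) (acc ++ p ∷ rest) F
    walkAgree-next acc {p} {F} pos ag a b x<a b≤n+1 = begin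
        F (a , b)
      ≡⟨ ag a b (<⇒≤ x<a) b≤n+1 ⟩
        markedInside x L a b ∨ ((x <ᵇ a) ∧ markedInside (suc x) acc a b)
      ≡⟨ cong (λ u → markedInside x L a b ∨ (u ∧ markedInside (suc x) acc a b)) (<ᵇ-true x<a) ⟩
        markedInside x L a b ∨ markedInside (suc x) acc a b
      ≡⟨ ∨-comm (markedInside x L a b) _ ⟩
        markedInside (suc x) acc a b ∨ markedInside x L a b
      ≡⟨ cong (λ v → markedInside (suc x) acc a b ∨ (((a <ᵇ v) ∧ (v <ᵇ b)) ∨ markedInside v rest a b)) (sym pos) ⟩
        markedInside (suc x) acc a b ∨ markedInside (suc x + gapSum acc) (p ∷ rest) a b
      ≡⟨ sym (markedInside-++ (suc x) acc (p ∷ rest) a b) ⟩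
        markedInside (suc x) (acc ++ p ∷ rest) a b ∎
      where open ≡-Reasoning

    open-until-t : ∀ acc {F Y} → WalkAgree acc F → Y ≤ t → F (x , Y) ≡ false
    open-until-t acc {F} {Y} ag Y≤t
      rewrite ag x Y ≤-refl (≤-trans Y≤t t≤n+1) | <ᵇ-false {t} {Y} Y≤t
            | markedInside-before t rest x Y Y≤t | <ᵇ-irrefl x | ∧-zeroʳ (x <ᵇ t) = refl

    closed-after-t : ∀ acc {F b} → WalkAgree acc F → t < b → b ≤ suc n → F (x , b) ≡ true
    closed-after-t acc ag t<b b≤n+1 rewrite ag x _ ≤-refl b≤n+1 | <ᵇ-true x<t | <ᵇ-true t<b = refl

    -- t being marked already, a solid diagonal (x , t) forbids nothing new
    forbidAcross-t : ∀ acc {F} → WalkAgree acc F → ∀ α → InRows x α → forbidAcross F (x , t) α ≡ F α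
    forbidAcross-t acc ag (a , b) (x≤a , b≤n+1) rewrite ag a b x≤a b≤n+1 | <ᵇ-false {a} {x} x≤a =
      absorb ((a <ᵇ t) ∧ (t <ᵇ b)) (markedInside t rest a b) ((x <ᵇ a) ∧ markedInside (suc x) acc a b) (x <ᵇ a)
      where
      absorb : ∀ P Q R X → ((P ∨ Q) ∨ R) ∨ ((X ∧ P) ∨ false) ≡ (P ∨ Q) ∨ R
      absorb true  Q     R     X     = refl
      absorb false true  R     X     = refl
      absorb false false true  X     = refl
      absorb false false false false = refl
      absorb false false false true  = refl

    after-t-forbidden : ∀ acc {F} → WalkAgree acc F →
      All (λ α → isDiagonal n α ≡ true × F α ≡ true) (row x (suc t) (gapSum rest))
    after-t-forbidden acc {F} ag = byBase baseSafe
      where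
      Forced : Arc → Set
      Forced α = isDiagonal n α ≡ true × F α ≡ true
      forced : 2 ≤ x → ∀ {α} → proj₁ α ≡ x × suc t ≤ proj₂ α × proj₂ α < suc t + gapSum rest → Forced α
      forced 2≤x {(.x , b)} (refl , t<b , b<) =
        isDiagonal-inner x b (≤-trans (s≤s x<t) t<b) (inj₁ 2≤x) ,
        closed-after-t acc ag t<b (≤-pred (≤-trans b< (s≤s (≤-reflexive ends))))
      byBase : 2 ≤ x ⊎ rest ≡ [] → All Forced (row x (suc t) (gapSum rest))
      byBase (inj₁ 2≤x)    = All.map (forced 2≤x) (row-bounds x (suc t) (gapSum rest))
      byBase (inj₂ noRest) = subst (λ r → All Forced (row x (suc t) (gapSum r))) (sym noRest) []

    T-InRows : All (InRows x) (row x (suc t) (gapSum rest) ++ rows (suc x) k)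
    T-InRows = ++⁺ (All.map (λ { (refl , _ , b<) → ≤-refl , ≤-pred (≤-trans b< (s≤s (≤-reflexive ends))) })
                            (row-bounds x (suc t) (gapSum rest)))
                   (All.map (λ (x<a , b≤) → <⇒≤ x<a , b≤) (rows-InRows (suc x) k later-rows-end))

    -- The arc (x , t) takes any of the m labels (solid, it forbids nothing new; or
    -- it is the base), the later arcs of the row are forced, and the next row starts
    -- with the gaps cut off in this row followed by the remaining ones.
    closeGap : ∀ acc {p F} → suc x + gapSum acc + suc p ≡ t → WalkAgree acc F →
      labelings n (row x t (suc (gapSum rest)) ++ rows (suc x) k) F ≡ m * fill k (acc ++ p ∷ rest)
    closeGap acc {p} {F} pos ag = begin
        labelings n ((x , t) ∷ T) F
      ≡⟨ arc-to-t (isDiagonal n (x , t)) refl ⟩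
        m * labelings n T F
      ≡⟨ cong (m *_) (labelings-forbidden (row x (suc t) (gapSum rest)) (rows (suc x) k) F (after-t-forbidden acc ag)) ⟩
        m * labelings n (rows (suc x) k) F
      ≡⟨ cong (m *_) (next (acc ++ p ∷ rest) F gaps (walkAgree-next acc pos ag)) ⟩
        m * fill k (acc ++ p ∷ rest) ∎
      where
      open ≡-Reasoning
      T = row x (suc t) (gapSum rest) ++ rows (suc x) k
      arc-to-t : ∀ d → isDiagonal n (x , t) ≡ d → labelings n ((x , t) ∷ T) F ≡ m * labelings n T F
      arc-to-t false isD rewrite isD = refl
      arc-to-t true  isD = begin
          labelings n ((x , t) ∷ T) F
        ≡⟨ labelings-open (x , t) T F isD (open-until-t acc ag ≤-refl) ⟩
          labelings n T F + w * labelings n T (forbidAcross F (x , t))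
        ≡⟨ cong (λ u → labelings n T F + w * u) (labelings-cong T (InRows x) T-InRows (forbidAcross-t acc ag)) ⟩
          suc w * labelings n T F
        ≡⟨ cong (_* labelings n T F) (sym m≡1+w) ⟩
          m * labelings n T F ∎
      cut : gapSum acc + suc p ≡ suc ℓ
      cut = +-cancelˡ-≡ (suc x) _ _ (trans (sym (+-assoc (suc x) (gapSum acc) (suc p))) (trans pos (+-suc x (suc ℓ))))
      gaps : gapSum (acc ++ p ∷ rest) ≡ k
      gaps = trans (gapSum-++ acc (p ∷ rest))
                   (trans (sym (+-assoc (gapSum acc) (suc p) (gapSum rest))) (trans (cong (_+ gapSum rest) cut) sizes))

    walk : ∀ q {acc p Y F} → suc x + gapSum acc + suc p ≡ Y → Y + q ≡ t → WalkAgree acc F →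
      labelings n (row x Y (suc (q + gapSum rest)) ++ rows (suc x) k) F ≡ fillRow k acc p q rest
    walk zero {acc} {p} {Y} {F} pos end ag =
      trans (cong (λ y → labelings n (row x y (suc (gapSum rest)) ++ rows (suc x) k) F) Y≡t)
            (closeGap acc (trans pos Y≡t) ag)
      where
      Y≡t : Y ≡ t
      Y≡t = trans (sym (+-identityʳ Y)) end
    walk (suc q) {acc} {p} {Y} {F} pos end ag =
      trans (labelings-open (x , Y) (row x (suc Y) (suc (q + gapSum rest)) ++ rows (suc x) k) F
                            (isDiagonal-inner x Y x+1<Y (inj₂ Y≤n)) (open-until-t acc ag (<⇒≤ Y<t)))
            (cong₂ (λ u v → u + w * v) (walk q unitPos end′ ag) (walk q cutPos end′ (walkAgree-cut acc pos ag)))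
      where
      Y<t : Y < t
      Y<t = ≤-trans (m<m+n Y (s≤s z≤n)) (≤-reflexive end)
      Y≤n : Y ≤ n
      Y≤n = ≤-pred (≤-trans Y<t t≤n+1)
      x+1<Y : suc x < Y
      x+1<Y = ≤-trans (s≤s (m≤m+n (suc x) (gapSum acc + p)))
                      (≤-reflexive (trans (shape (suc x) (gapSum acc) p) pos))
        where
        shape : ∀ x g p → suc (x + (g + p)) ≡ x + g + suc p
        shape = solve-∀
      end′ : suc Y + q ≡ t
      end′ = trans (sym (+-suc Y q)) end
      unitPos : suc x + gapSum acc + suc (suc p) ≡ suc Y
      unitPos = trans (+-suc (suc x + gapSum acc) (suc p)) (cong suc pos)
      cutPos : suc x + gapSum (acc ++ p ∷ []) + 1 ≡ suc Y
      cutPos = trans (cong (λ g → suc x + g + 1) (gapSum-++ acc (p ∷ []))) (trans (shape (suc x) (gapSum acc) p) (cong suc pos))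
        where
        shape : ∀ x g p → x + (g + (suc p + 0)) + 1 ≡ suc (x + g + suc p)
        shape = solve-∀

    walkRow : ∀ {F} → Agree x L F → labelings n (rows x (suc k)) F ≡ fill (suc k) L
    walkRow {F} ag rewrite isDiagonal-edge x = cong (m *_) (begin
        labelings n (row x (suc (suc x)) k ++ rows (suc x) k) F
      ≡⟨ cong (λ j → labelings n (row x (suc (suc x)) j ++ rows (suc x) k) F) (sym sizes) ⟩
        labelings n (row x (suc (suc x)) (suc (ℓ + gapSum rest)) ++ rows (suc x) k) F
      ≡⟨ walk ℓ (startPos x) (startEnd x ℓ) (walkAgree-start ag) ⟩
        fillRow k [] 0 ℓ rest ∎)
      where
      open ≡-Reasoning
      startPos : ∀ x → suc x + 0 + 1 ≡ suc (suc x)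
      startPos = solve-∀
      startEnd : ∀ x ℓ → suc (suc x) + ℓ ≡ x + suc (suc ℓ)
      startEnd = solve-∀

  -- The rows x, x+1, … (x ≥ 2, so none of them contains the base) with marked vertices L.
  rows-fill : ∀ k x L F → x + k ≡ suc n → gapSum L ≡ k → 2 ≤ x → Agree x L F → labelings n (rows x k) F ≡ fill k L
  rows-fill zero    x []            F ends sizes 2≤x ag = refl
  rows-fill (suc k) x (zero ∷ rest) F ends sizes 2≤x ag rewrite isDiagonal-edge x =
    cong (m *_) (trans (labelings-forbidden (row x (suc (suc x)) k) (rows (suc x) k) F
                                             (All.map forced (row-bounds x (suc (suc x)) k)))
                       (rows-fill k (suc x) rest F ends′ (suc-injective sizes) (≤-trans 2≤x (n≤1+n x)) ag′))
    where
    -- the vertex x+1 is marked: every other arc of row x is forced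
    ends′ : suc x + k ≡ suc n
    ends′ = trans (sym (+-suc x k)) ends
    forced : ∀ {α} → proj₁ α ≡ x × suc (suc x) ≤ proj₂ α × proj₂ α < suc (suc x) + k →
      isDiagonal n α ≡ true × F α ≡ true
    forced {(.x , b)} (refl , x+1<b , b<) rewrite ag x b ≤-refl (≤-pred (≤-trans b< (s≤s (≤-reflexive ends′))))
      | <ᵇ-true (m<m+n x (s≤s (z≤n {0}))) | <ᵇ-true {x + 1} {b} (≤-trans (s≤s (≤-reflexive (+-comm x 1))) x+1<b) =
      isDiagonal-inner x b x+1<b (inj₁ 2≤x) , refl
    ag′ : Agree (suc x) rest F
    ag′ a b x<a b≤n+1 rewrite ag a b (<⇒≤ x<a) b≤n+1 | <ᵇ-false {a} {x + 1} (≤-trans (≤-reflexive (+-comm x 1)) x<a) =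
      cong (λ v → markedInside v rest a b) (+-comm x 1)
  rows-fill (suc k) x (suc ℓ ∷ rest) F ends sizes 2≤x ag =
    Walk.walkRow x ℓ k rest ends′ (suc-injective sizes) (inj₁ 2≤x) next ag
    where
    ends′ : x + suc (suc ℓ) + gapSum rest ≡ suc n
    ends′ = trans (+-assoc x (suc (suc ℓ)) (gapSum rest)) (trans (cong (x +_) sizes) ends)
    next : ∀ L F → gapSum L ≡ k → Agree (suc x) L F → labelings n (rows (suc x) k) F ≡ fill k L
    next L′ F′ sizes′ ag′ =
      rows-fill k (suc x) L′ F′ (trans (sym (+-suc x k)) ends) sizes′ (≤-trans 2≤x (n≤1+n x)) ag′

  -- All rows of a clique of size n = ℓ + 2: initially only the last vertex n+1 is
  -- marked, and the first row, which ends with the base, is walked directly.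
  allRows : ∀ ℓ → suc (suc ℓ) ≡ n → labelings n (rows 1 n) (λ _ → false) ≡ single (suc ℓ)
  allRows ℓ refl = Walk.walkRow 1 ℓ (suc ℓ) [] (+-identityʳ _) (+-identityʳ (suc ℓ)) (inj₂ refl) next nothingMarked
    where
    next : ∀ L F → gapSum L ≡ suc ℓ → Agree 2 L F → labelings n (rows 2 (suc ℓ)) F ≡ fill (suc ℓ) L
    next L F sizes ag = rows-fill (suc ℓ) 2 L F refl sizes ≤-refl ag
    nothingMarked : Agree 1 (suc ℓ ∷ []) (λ _ → false)
    nothingMarked a b _ b≤n+1 rewrite <ᵇ-false {suc n} {b} b≤n+1 | ∧-zeroʳ (a <ᵇ suc n) = refl

module Dimensions {m : ℕ} (M : FiniteUnitaryMagma m) where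
  open SequentialCount M using (w; m≡1+w; labelings; dimNC≡labelings)
  open GapCounts m w using (single; single-recurrence)
  open Convolution
  open import Data.Nat using (suc; _+_; _*_)
  open import Data.Nat.Properties using (*-identityʳ; *-zeroʳ; +-identityʳ)
  open import Data.Nat.Tactic.RingSolver using (solve-∀)
  open import Data.Bool using (false)
  open import Relation.Binary.PropositionalEquality

  d : ℕ → ℕ
  d = dimNC M

  dimNC≡single : ∀ j → d (suc (suc j)) ≡ single (suc j)
  dimNC≡single j = begin
      d n
    ≡⟨ dimNC≡labelings j ⟩
      labelings n (arcs n) (λ _ → false)
    ≡⟨ cong (λ as → labelings n as (λ _ → false)) (ArcRows.arcs≡rows n) ⟩
      labelings n (ArcRows.rows 1 n) (λ _ → false)
    ≡⟨ RowByRow.allRows M n j refl ⟩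
      single (suc j) ∎
    where
    open ≡-Reasoning
    n = suc (suc j)

  -- the triangle has three arcs and no diagonal
  dimNC-2 : d 2 ≡ m * (m * (m * 1))
  dimNC-2 = dimNC≡single 0

  square-coefficient-2 : conv d d 3 ≡ 1
  square-coefficient-2 = cong suc (trans (+-identityʳ (d 2 * 0)) (*-zeroʳ (d 2)))

  middle : ℕ → ℕ
  middle l = conv (λ i → d (suc (suc i))) (λ i → d (suc (suc i))) l

  -- since d 0 = 0 and d 1 = 1, the coefficient of t^(l+3) in H² is 2 d (l+2) + middle l
  square-coefficient : ∀ l → conv d d (suc (suc (suc (suc l)))) ≡ 2 * d (suc (suc l)) + middle l
  square-coefficient l = begin
      0 * d (3 + l) + (1 * d (2 + l) + conv inner d (2 + l))
    ≡⟨ cong (λ c → 0 * d (3 + l) + (1 * d (2 + l) + c)) (conv-last (suc l) inner d) ⟩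
      0 * d (3 + l) + (1 * d (2 + l) + (conv inner (λ i → d (suc i)) (suc l) + d (3 + l) * 0))
    ≡⟨ cong (λ c → 0 * d (3 + l) + (1 * d (2 + l) + (c + d (3 + l) * 0))) (conv-last l inner (λ i → d (suc i))) ⟩
      0 * d (3 + l) + (1 * d (2 + l) + ((middle l + d (2 + l) * 1) + d (3 + l) * 0))
    ≡⟨ collect (d (3 + l)) (d (2 + l)) (middle l) ⟩
      2 * d (2 + l) + middle l ∎
    where
    open ≡-Reasoning
    inner : ℕ → ℕ
    inner i = d (suc (suc i))
    collect : ∀ e a s → 0 * e + (1 * a + ((s + a * 1) + e * 0)) ≡ 2 * a + s
    collect = solve-∀

  dimNC-recurrence : ∀ l → d (suc (suc (suc l))) ≡ m * m * d (suc (suc l)) + w * (m * d (suc (suc l)) + middle l)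
  dimNC-recurrence l = begin
      d (3 + l)
    ≡⟨ dimNC≡single (suc l) ⟩
      single (2 + l)
    ≡⟨ single-recurrence l ⟩
      m * m * single (1 + l) + w * (single 0 * single (1 + l) + conv (λ i → single (suc i)) (λ i → single (suc i)) l)
    ≡⟨ cong₂ (λ a s → m * m * a + w * (single 0 * a + s)) (sym (dimNC≡single l))
             (conv-cong l (λ i → sym (dimNC≡single i)) (λ i → sym (dimNC≡single i))) ⟩
      m * m * d (2 + l) + w * (m * 1 * d (2 + l) + middle l)
    ≡⟨ cong (λ c → m * m * d (2 + l) + w * (c * d (2 + l) + middle l)) (*-identityʳ m) ⟩
      m * m * d (2 + l) + w * (m * d (2 + l) + middle l) ∎
    where open ≡-Reasoning

  -- With m = w + 1 the coefficient 2m² - 3m + 2 of the equation is 2w² + w + 1, and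
  -- the recurrence reads  d (l+3) = (2w² + w + 1) d (l+2) + w [t^(l+3)] H².
  dimNC-recurrence-w : ∀ l → d (suc (suc (suc l))) ≡ (2 * w * w + w + 1) * d (suc (suc l)) + w * conv d d (suc (suc (suc (suc l))))
  dimNC-recurrence-w l = begin
      d (3 + l)
    ≡⟨ dimNC-recurrence l ⟩
      m * m * d (2 + l) + w * (m * d (2 + l) + middle l)
    ≡⟨ cong (λ μ → μ * μ * d (2 + l) + w * (μ * d (2 + l) + middle l)) m≡1+w ⟩
      suc w * suc w * d (2 + l) + w * (suc w * d (2 + l) + middle l)
    ≡⟨ regroup w (d (2 + l)) (middle l) ⟩
      (2 * w * w + w + 1) * d (2 + l) + w * (2 * d (2 + l) + middle l)
    ≡⟨ cong (λ c → (2 * w * w + w + 1) * d (2 + l) + w * c) (sym (square-coefficient l)) ⟩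
      (2 * w * w + w + 1) * d (2 + l) + w * conv d d (4 + l) ∎
    where
    open ≡-Reasoning
    regroup : ∀ w a s → suc w * suc w * a + w * (suc w * a + s) ≡ (2 * w * w + w + 1) * a + w * (2 * a + s)
    regroup = solve-∀

module SeriesCoefficients where
  open Convolution
  open import Data.Nat as ℕ using (ℕ; zero; suc; _∸_)
  open import Data.Integer using (ℤ; +_; _+_; _*_)
  open import Data.Integer.Properties using (pos-+; pos-*; *-zeroʳ; *-zeroˡ; +-identityˡ)
  open import Data.Integer.Tactic.RingSolver using (solve-∀)
  open import Data.List using (map; foldr; applyUpTo)
  open import Data.List.Properties using (map-upTo)
  open import Relation.Binary.PropositionalEquality

  cauchy : ∀ q (a b : ℕ → ℕ) →
    foldr _+_ (+ 0) (applyUpTo (λ i → + a i * + b (q ∸ i)) (suc q)) ≡ + conv a b (suc q)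
  cauchy zero    a b = trans (cong (_+ + 0) (sym (pos-* (a 0) (b 0)))) (sym (pos-+ (a 0 ℕ.* b 0) 0))
  cauchy (suc q) a b = trans (cong₂ _+_ (sym (pos-* (a 0) (b (suc q)))) (cauchy q (λ i → a (suc i)) b))
                             (sym (pos-+ (a 0 ℕ.* b (suc q)) _))

  square-series : ∀ (d : ℕ → ℕ) n → ((λ i → + d i) ⊛ (λ i → + d i)) n ≡ + conv d d (suc n)
  square-series d n = trans (cong (foldr _+_ (+ 0)) (map-upTo (λ i → + d i * + d (n ∸ i)) (suc n))) (cauchy n d d)

  sum-of-zeros : ∀ k (f : ℕ → ℕ) (g : ℕ → ℤ) → (∀ j → g (f j) ≡ + 0) →
    foldr _+_ (+ 0) (map g (applyUpTo f k)) ≡ + 0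
  sum-of-zeros zero    f g zeros = refl
  sum-of-zeros (suc k) f g zeros rewrite zeros 0 =
    trans (+-identityˡ _) (sum-of-zeros k (λ i → f (suc i)) g (λ j → zeros (suc j)))

  linear-times : ∀ c e (H : PS) n → ((c · 𝐭 ⊕ const e) ⊛ H) (suc n) ≡ e * H (suc n) + c * H n
  linear-times c e H n = begin
      (c * + 0 + e) * H (suc n) + ((c * + 1 + + 0) * H n + foldr _+_ (+ 0) (map g (applyUpTo (λ i → suc (suc i)) n)))
    ≡⟨ cong (λ r → (c * + 0 + e) * H (suc n) + ((c * + 1 + + 0) * H n + r)) (sum-of-zeros n _ g higher) ⟩
      (c * + 0 + e) * H (suc n) + ((c * + 1 + + 0) * H n + + 0)
    ≡⟨ simplify c e (H (suc n)) (H n) ⟩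
      e * H (suc n) + c * H n ∎
    where
    open ≡-Reasoning
    g : ℕ → ℤ
    g i = (c · 𝐭 ⊕ const e) i * H (suc n ∸ i)
    higher : ∀ j → g (suc (suc j)) ≡ + 0
    higher j rewrite *-zeroʳ c = *-zeroˡ (H (n ∸ suc j))
    simplify : ∀ c e a b → (c * + 0 + e) * a + ((c * + 1 + + 0) * b + + 0) ≡ e * a + c * b
    simplify = solve-∀

open import Data.Integer using (ℤ; +_; _+_; _-_; _*_)
open import Data.Integer.Properties using (pos-+; pos-*)
open import Data.Integer.Tactic.RingSolver using (solve-∀)
open import Relation.Binary.PropositionalEquality using (_≡_; refl; sym; cong; cong₂; trans; module ≡-Reasoning)

module EquationCoefficients {m : ℕ} (M : FiniteUnitaryMagma m) where
  open SequentialCount M using (w; m≡1+w)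
  open Dimensions M using (d; dimNC-2; square-coefficient-2; dimNC-recurrence-w)
  open Convolution using (conv)
  import Data.Nat as ℕ
  open import Data.Product using (_×_; _,_)
  open ≡-Reasoning

  μ : ℤ
  μ = + m

  c₂ c₁ : ℤ
  c₂ = μ * μ * μ - + 2 * μ * μ + + 2 * μ - + 1
  c₁ = + 2 * μ * μ - + 3 * μ + + 2

  H : PS
  H = hilbert M

  coefficient : ℕ → ℤ
  coefficient n = (𝐭 (suc n) + c₂ * tpow 2 (suc n) + ((+ 0 - + 1) * H (suc n) + c₁ * H n))
                  + (μ - + 1) * + conv d d (suc (suc n))

  dimNC-2ℤ : + d 2 ≡ μ * (μ * (μ * + 1))
  dimNC-2ℤ = trans (cong +_ dimNC-2) (trans (pos-* m _) (cong (μ *_) (trans (pos-* m _) (cong (μ *_) (pos-* m 1)))))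

  in-terms-of-w : c₁ ≡ + 2 * + w * + w + + w + + 1 × μ - + 1 ≡ + w
  in-terms-of-w = substitute μ (+ w) (cong +_ m≡1+w)
    where
    substitute : ∀ μ W → μ ≡ + 1 + W → (+ 2 * μ * μ - + 3 * μ + + 2 ≡ + 2 * W * W + W + + 1) × (μ - + 1 ≡ W)
    substitute .(+ 1 + W) W refl = c-in-w W , shift W
      where
      c-in-w : ∀ W → + 2 * (+ 1 + W) * (+ 1 + W) - + 3 * (+ 1 + W) + + 2 ≡ + 2 * W * W + W + + 1
      c-in-w = solve-∀
      shift : ∀ W → (+ 1 + W) - + 1 ≡ W
      shift = solve-∀

  cast : ∀ a v → + ((2 ℕ.* w ℕ.* w ℕ.+ w ℕ.+ 1) ℕ.* a ℕ.+ w ℕ.* v) ≡ (+ 2 * + w * + w + + w + + 1) * + a + + w * + v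
  cast a v = begin
      + (c ℕ.* a ℕ.+ w ℕ.* v)
    ≡⟨ pos-+ (c ℕ.* a) (w ℕ.* v) ⟩
      + (c ℕ.* a) + + (w ℕ.* v)
    ≡⟨ cong₂ _+_ (pos-* c a) (pos-* w v) ⟩
      + c * + a + + w * + v
    ≡⟨ cong (λ z → z * + a + + w * + v) c-cast ⟩
      (+ 2 * + w * + w + + w + + 1) * + a + + w * + v ∎
    where
    c = 2 ℕ.* w ℕ.* w ℕ.+ w ℕ.+ 1
    c-cast : + c ≡ + 2 * + w * + w + + w + + 1
    c-cast = trans (pos-+ (2 ℕ.* w ℕ.* w ℕ.+ w) 1) (cong (_+ + 1) (trans (pos-+ (2 ℕ.* w ℕ.* w) w)
               (cong (_+ + w) (trans (pos-* (2 ℕ.* w) w) (cong (_* + w) (pos-* 2 w))))))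

  recurrenceℤ : ∀ l → H (3 ℕ.+ l) ≡ c₁ * H (2 ℕ.+ l) + (μ - + 1) * + conv d d (4 ℕ.+ l)
  recurrenceℤ l with in-terms-of-w
  ... | c₁≡ , μ-1≡ = begin
      + d (3 ℕ.+ l)
    ≡⟨ cong +_ (dimNC-recurrence-w l) ⟩
      + ((2 ℕ.* w ℕ.* w ℕ.+ w ℕ.+ 1) ℕ.* d (2 ℕ.+ l) ℕ.+ w ℕ.* conv d d (4 ℕ.+ l))
    ≡⟨ cast (d (2 ℕ.+ l)) (conv d d (4 ℕ.+ l)) ⟩
      (+ 2 * + w * + w + + w + + 1) * H (2 ℕ.+ l) + + w * + conv d d (4 ℕ.+ l)
    ≡⟨ cong₂ (λ c W → c * H (2 ℕ.+ l) + W * + conv d d (4 ℕ.+ l)) (sym c₁≡) (sym μ-1≡) ⟩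
      c₁ * H (2 ℕ.+ l) + (μ - + 1) * + conv d d (4 ℕ.+ l) ∎

  coefficient-vanishes : ∀ n → coefficient n ≡ + 0
  coefficient-vanishes zero = degree1 c₂ c₁ (μ - + 1)
    where
    degree1 : ∀ K c W → (+ 1 + K * + 0 + ((+ 0 - + 1) * + 1 + c * + 0)) + W * + 0 ≡ + 0
    degree1 = solve-∀
  coefficient-vanishes (suc zero) = trans
    (cong₂ (λ D C → (+ 0 + c₂ * + 1 + ((+ 0 - + 1) * D + c₁ * + 1)) + (μ - + 1) * C) dimNC-2ℤ (cong +_ square-coefficient-2))
    (degree2 μ)
    where
    degree2 : ∀ μ → (+ 0 + (μ * μ * μ - + 2 * μ * μ + + 2 * μ - + 1) * + 1
                      + ((+ 0 - + 1) * (μ * (μ * (μ * + 1))) + (+ 2 * μ * μ - + 3 * μ + + 2) * + 1))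
                    + (μ - + 1) * + 1 ≡ + 0
    degree2 = solve-∀
  coefficient-vanishes (suc (suc l)) = trans
    (cong (λ D → (+ 0 + c₂ * + 0 + ((+ 0 - + 1) * D + c₁ * H (2 ℕ.+ l))) + (μ - + 1) * + conv d d (4 ℕ.+ l)) (recurrenceℤ l))
    (higher c₂ c₁ (μ - + 1) (H (2 ℕ.+ l)) (+ conv d d (4 ℕ.+ l)))
    where
    higher : ∀ K c W A C → (+ 0 + K * + 0 + ((+ 0 - + 1) * (c * A + W * C) + c * A)) + W * C ≡ + 0
    higher = solve-∀

proposition3p2 : (m : ℕ) (M : FiniteUnitaryMagma m) →
    let μ = + m
        H = hilbert M
    in ∀ n →
      (𝐭
        ⊕ ((μ * μ * μ - + 2 * μ * μ + + 2 * μ - + 1) · tpow 2)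
        ⊕ (((+ 2 * μ * μ - + 3 * μ + + 2) · 𝐭) ⊕ const (+ 0 - + 1)) ⊛ H
        ⊕ (μ - + 1) · (H ⊛ H)) n
      ≡ 𝟘 n
proposition3p2 m M zero = no-constant-term c₂ (μ - + 1) (c₁ * + 0 + (+ 0 - + 1))
  where
  open EquationCoefficients M using (μ; c₂; c₁)
  no-constant-term : ∀ K W x → ((+ 0 + K * + 0) + (x * + 0 + + 0)) + W * (+ 0 * + 0 + + 0) ≡ + 0
  no-constant-term = solve-∀
proposition3p2 m M (suc n) = begin
    (𝐭 (suc n) + c₂ * tpow 2 (suc n) + ((c₁ · 𝐭 ⊕ const (+ 0 - + 1)) ⊛ H) (suc n)) + (μ - + 1) * (H ⊛ H) (suc n)
  ≡⟨ cong₂ (λ u v → (𝐭 (suc n) + c₂ * tpow 2 (suc n) + u) + (μ - + 1) * v)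
           (linear-times c₁ (+ 0 - + 1) H n) (square-series (dimNC M) (suc n)) ⟩
    coefficient n
  ≡⟨ coefficient-vanishes n ⟩
    + 0 ∎
  where
  open ≡-Reasoning
  open EquationCoefficients M using (μ; c₂; c₁; H; coefficient; coefficient-vanishes)
  open SeriesCoefficients using (square-series; linear-times)
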